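{- Let $X$ be a finite set with $|X|\ge3$ and let $\mathfrak D\subseteq\mathfrak C^{\mathrm{full}}$ be non-empty, symmetric and balanced. Then for any pairwise distinct $x,y,z\in X$, $\bar t^{\langle x,y,z\rangle}\in\mathrm{pr\text{ - }cl}(\mathfrak D)$.
   Context: $\mathfrak C^{\mathrm{full}}$ is the set of choice functions $c$ on all two-element subsets of $X$ ($c\{x,y\}\in\{x,y\}$). A permutation $\pi$ of $X$ acts by $\hat\pi(c)\{\pi(x),\pi(y)\}=\pi(c\{x,y\})$; symmetric means closed under this action. $c$ is balanced if $|\{y\ne x:c\{x,y\}=y\}|=(|X|-1)/2$ for every $x$; $\mathfrak D$ is balanced if all its members are. For full $d$, $\bar t[d]=\langle t_{u,v}[d]:u\ne v\rangle$ with $t_{u,v}[d]=1$ if $d\{u,v\}=v$ and $0$ otherwise; $\mathrm{pr\text{ - }cl}(\mathfrak D)$ is the convex hull of $\{\bar t[d]:d\in\mathfrak D\}$. For distinct $x,y,z$, $\bar t^{\langle x,y,z\rangle}=\langle t_{u,v}:u\ne v\rangle$ is given by $t_{u,v}=1$ for $(u,v)\in\{(x,y),(y,z),(z,x)\}$, $t_{u,v}=0$ for $(u,v)\in\{(y,x),(z,y),(x,z)\}$, and $t_{u,v}=\tfrac12$ otherwise. -}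

module Defs where

open import Data.Nat using (ℕ; _∸_; _*_)
open import Data.Fin using (Fin; _≟_)
open import Data.Fin.Permutation using (Permutation′; _⟨$⟩ʳ_; _⟨$⟩ˡ_; inverseʳ)
open import Data.List using (List; []; _∷_; length; filter; allFin)
open import Data.Product using (Σ; _×_; _,_; proj₁; proj₂)
open import Data.Sum using (_⊎_; inj₁; inj₂)
open import Data.Rational as ℚ using (ℚ; 0ℚ; 1ℚ; ½)
open import Relation.Binary.PropositionalEquality using (_≡_; _≢_; refl; sym; trans; cong)
open import Relation.Nullary using (yes; no; ¬_)
open import Relation.Nullary.Decidable using (_×-dec_; ¬?)

-- A choice function on the two-element subsets of X = Fin n, represented
-- as a function c : X → X → X with c x y = c {x,y}.  The symmetry field
-- makes it a function of the unordered pair; the choice field forces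
-- c x y ∈ {x, y} (in particular c x x = x, so the diagonal carries no data).
record ChoiceFn (n : ℕ) : Set where
  field
    ch     : Fin n → Fin n → Fin n
    ch-sym : ∀ x y → ch x y ≡ ch y x
    ch-in  : ∀ x y → ch x y ≡ x ⊎ ch x y ≡ y
open ChoiceFn public

Family : ℕ → Set₁
Family n = ChoiceFn n → Set

-- The action  π̂(c){π x, π y} = π (c {x, y}),  i.e.
-- π̂(c){a, b} = π (c {π⁻¹ a, π⁻¹ b}).
act : ∀ {n} → Permutation′ n → ChoiceFn n → ChoiceFn n
act {n} π c = record { ch = f ; ch-sym = s ; ch-in = i }
  where
  f : Fin n → Fin n → Fin n
  f a b = π ⟨$⟩ʳ ch c (π ⟨$⟩ˡ a) (π ⟨$⟩ˡ b)
  s : ∀ a b → f a b ≡ f b a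
  s a b = cong (π ⟨$⟩ʳ_) (ch-sym c (π ⟨$⟩ˡ a) (π ⟨$⟩ˡ b))
  i : ∀ a b → f a b ≡ a ⊎ f a b ≡ b
  i a b with ch-in c (π ⟨$⟩ˡ a) (π ⟨$⟩ˡ b)
  ... | inj₁ e = inj₁ (trans (cong (π ⟨$⟩ʳ_) e) (inverseʳ π))
  ... | inj₂ e = inj₂ (trans (cong (π ⟨$⟩ʳ_) e) (inverseʳ π))

Symmetric : ∀ {n} → Family n → Set
Symmetric {n} 𝔇 = ∀ (π : Permutation′ n) (c : ChoiceFn n) → 𝔇 c → 𝔇 (act π c)

NonEmpty : ∀ {n} → Family n → Set
NonEmpty {n} 𝔇 = Σ (ChoiceFn n) 𝔇

winCount : ∀ {n} → ChoiceFn n → Fin n → ℕ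
winCount {n} c x =
  length (filter (λ y → ¬? (y ≟ x) ×-dec (ch c x y ≟ y)) (allFin n))

-- c balanced:  |{ y ≠ x : c{x,y} = y }| = (|X| - 1)/2  for every x,
-- written (without division) as  2 · count = |X| - 1.
Balanced : ∀ {n} → ChoiceFn n → Set
Balanced {n} c = ∀ x → 2 * winCount c x ≡ n ∸ 1

BalancedFamily : ∀ {n} → Family n → Set
BalancedFamily {n} 𝔇 = ∀ c → 𝔇 c → Balanced c

t : ∀ {n} → ChoiceFn n → Fin n → Fin n → ℚ
t d u v with ch d u v ≟ v
... | yes _ = 1ℚ
... | no  _ = 0ℚ

t³ : ∀ {n} → Fin n → Fin n → Fin n → Fin n → Fin n → ℚ
t³ x y z u v with u ≟ x | v ≟ y | u ≟ y | v ≟ z | u ≟ z | v ≟ x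
... | yes _ | yes _ | _ | _ | _ | _ = 1ℚ
... | _ | _ | yes _ | yes _ | _ | _ = 1ℚ
... | _ | _ | _ | _ | yes _ | yes _ = 1ℚ
... | _ | _ | _ | _ | _ | _ with u ≟ y | v ≟ x | u ≟ z | v ≟ y | u ≟ x | v ≟ z
...   | yes _ | yes _ | _ | _ | _ | _ = 0ℚ
...   | _ | _ | yes _ | yes _ | _ | _ = 0ℚ
...   | _ | _ | _ | _ | yes _ | yes _ = 0ℚ
...   | _ | _ | _ | _ | _ | _ = ½

sumℚ : List ℚ → ℚ
sumℚ [] = 0ℚ
sumℚ (q ∷ qs) = q ℚ.+ sumℚ qs

map′ : ∀ {A B : Set} → (A → B) → List A → List B
map′ f [] = []
map′ f (a ∷ as) = f a ∷ map′ f as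

data AllL {A : Set} (P : A → Set) : List A → Set where
  []  : AllL P []
  _∷_ : ∀ {a as} → P a → AllL P as → AllL P (a ∷ as)

InPrCl : ∀ {n} → Family n → (Fin n → Fin n → ℚ) → Set
InPrCl {n} 𝔇 p =
  Σ (List (ℚ × ChoiceFn n)) λ ws →
      AllL (λ w → (0ℚ ℚ.≤ proj₁ w) × 𝔇 (proj₂ w)) ws
    × sumℚ (map′ proj₁ ws) ≡ 1ℚ
    × (∀ u v → u ≢ v →
         sumℚ (map′ (λ w → proj₁ w ℚ.* t (proj₂ w) u v) ws) ≡ p u v)

{-# OPTIONS --safe #-}

-- Every vertex of a balanced tournament d ∈ 𝔇 lies on a 3-cycle, so by symmetry of 𝔇 we
-- may assume that d has the cycle x → y → z.  Averaging t[d] over all permutations fixing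
-- x, y and z stays in pr-cl(𝔇), keeps the entries among x, y, z, and makes the matrix
-- invariant under all transpositions of the remaining points.  Every point of pr-cl(𝔇)
-- satisfies p(u,v) + p(v,u) = 1 and has row sums (n − 1)/2; with the invariance, the first
-- forces the entries between two remaining points to be ½, and the second, applied to the
-- rows of x, y and z, forces their entries towards the remaining points to be ½.  This is
-- t^⟨x,y,z⟩.

module Submission where

open import Defs
open import Data.Nat using (ℕ; _≤_)
open import Data.Fin using (Fin)
open import Relation.Binary.PropositionalEquality using (_≢_)

open import Data.Nat as ℕ using (zero; suc; _∸_)
import Data.Nat.Properties as ℕ
open import Data.Fin using (_≟_; fromℕ<)
open import Data.Fin.Properties using (injective⇒≤)
open import Data.Fin.Permutation as Perm using (Permutation′; _⟨$⟩ʳ_; _⟨$⟩ˡ_; inverseˡ; inverseʳ)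
open import Data.Fin.Permutation.Components using (transpose; transpose-inverse)
open import Data.Vec.Relation.Unary.All using ([]; _∷_)
open import Data.Vec.Relation.Unary.AllPairs using ([]; _∷_)
open import Data.Vec.Relation.Unary.Unique.Propositional.Properties using (lookup-injective)
open import Data.List using (List; []; _∷_; _++_; length; filter; allFin; lookup)
open import Data.List.Properties using (filter-notAll; length-tabulate)
open import Data.List.Membership.Propositional using (_∈_; _∉_)
open import Data.List.Membership.Propositional.Properties using (∈-filter⁺; ∈-filter⁻; ∈-allFin; ∈-lookup)
import Data.List.Relation.Unary.All as All
open import Data.List.Relation.Unary.Any as Any using (here; there)
open import Data.List.Relation.Unary.AllPairs using (_∷_)
open import Data.List.Relation.Unary.Unique.Propositional using (Unique)
open import Data.List.Relation.Unary.Unique.Propositional.Properties using (allFin⁺; filter⁺)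
open import Data.Rational as ℚ using (ℚ; 0ℚ; 1ℚ; ½; _+_; _*_; _-_; -_; 1/_)
import Data.Rational.Properties as ℚ
open import Data.Rational.Solver using (module +-*-Solver)
open +-*-Solver using (solve; _:+_; _:*_; _:-_; _:=_; con; :-_)
open import Algebra.Bundles using (CommutativeRing)
open import Algebra.Properties.Semiring.Mult (CommutativeRing.semiring ℚ.+-*-commutativeRing)
  using (×-assoc-*; ×-comm-*; ×-assocˡ) renaming (_×_ to _·_)
open import Data.Bool using (if_then_else_)
open import Data.Empty using (⊥-elim)
open import Data.Product using (Σ; ∃; ∃₂; _×_; _,_; proj₁; proj₂)
open import Data.Sum using (_⊎_; inj₁; inj₂)
open import Function using (id; _∘_)
open import Function.Definitions using (Injective)
open import Relation.Binary.PropositionalEquality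
  using (_≡_; refl; sym; trans; cong; cong₂; subst; ≢-sym; ≡-≟-identity; ≢-≟-identity; module ≡-Reasoning)
open import Relation.Nullary using (yes; no; ¬_; Dec; does)
open import Relation.Nullary.Decidable using (dec-true; dec-false; ¬?; _×-dec_)

open ≡-Reasoning

-- Transpositions

module _ {n : ℕ} where

  transpose-ˡ : ∀ (i j : Fin n) → transpose i j i ≡ j
  transpose-ˡ i j rewrite dec-true (i ≟ i) refl = refl

  transpose-ʳ : ∀ (i j : Fin n) → transpose i j j ≡ i
  transpose-ʳ i j with j ≟ i
  ... | yes j≡i = j≡i
  ... | no  _   rewrite dec-true (j ≟ j) refl = refl

  transpose-other : ∀ {i j k : Fin n} → k ≢ i → k ≢ j → transpose i j k ≡ k
  transpose-other {i} {j} {k} k≢i k≢j rewrite dec-false (k ≟ i) k≢i | dec-false (k ≟ j) k≢j = refl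

  transpose-comm : ∀ (i j k : Fin n) → transpose i j k ≡ transpose j i k
  transpose-comm i j k with i ≟ k | j ≟ k
  ... | yes refl | yes refl = refl
  ... | yes refl | no _     = trans (transpose-ˡ i j) (sym (transpose-ʳ j i))
  ... | no _     | yes refl = trans (transpose-ʳ i j) (sym (transpose-ˡ j i))
  ... | no i≢k   | no j≢k   =
    trans (transpose-other (≢-sym i≢k) (≢-sym j≢k)) (sym (transpose-other (≢-sym j≢k) (≢-sym i≢k)))

  transpose-involutive : ∀ (i j k : Fin n) → transpose i j (transpose i j k) ≡ k
  transpose-involutive i j k = trans (cong (transpose i j) (transpose-comm i j k)) (transpose-inverse i j)

  transpose-injective : ∀ (i j : Fin n) → Injective _≡_ _≡_ (transpose i j)
  transpose-injective i j {k} {l} e =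
    trans (sym (transpose-involutive i j k)) (trans (cong (transpose i j) e) (transpose-involutive i j l))

  transpose-self : ∀ (i k : Fin n) → transpose i i k ≡ k
  transpose-self i k with i ≟ k
  ... | yes refl = transpose-ˡ i i
  ... | no i≢k   = transpose-other (≢-sym i≢k) (≢-sym i≢k)

  transpose-natural : ∀ {f : Fin n → Fin n} → Injective _≡_ _≡_ f →
                      ∀ i j k → f (transpose i j k) ≡ transpose (f i) (f j) (f k)
  transpose-natural {f} f-inj i j k with i ≟ k | j ≟ k
  ... | yes refl | _        = trans (cong f (transpose-ˡ i j)) (sym (transpose-ˡ (f i) (f j)))
  ... | no _     | yes refl = trans (cong f (transpose-ʳ i j)) (sym (transpose-ʳ (f i) (f j)))
  ... | no i≢k   | no j≢k   = trans (cong f (transpose-other (≢-sym i≢k) (≢-sym j≢k)))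
    (sym (transpose-other (λ e → i≢k (sym (f-inj e))) (λ e → j≢k (sym (f-inj e)))))

  transpose-conj : ∀ {a b k : Fin n} → k ≢ a → k ≢ b → ∀ i w →
    transpose i k (transpose a b w) ≡ transpose a b (transpose (transpose a b i) k w)
  transpose-conj {a} {b} {k} k≢a k≢b i w = sym (begin
    transpose a b (transpose (transpose a b i) k w)
      ≡⟨ transpose-natural (transpose-injective a b) (transpose a b i) k w ⟩
    transpose (transpose a b (transpose a b i)) (transpose a b k) (transpose a b w)
      ≡⟨ cong₂ (λ j l → transpose j l (transpose a b w)) (transpose-involutive a b i) (transpose-other k≢a k≢b) ⟩
    transpose i k (transpose a b w) ∎)

  transpose-shift : ∀ {i k b : Fin n} → b ≢ i → b ≢ k → ∀ w →
    transpose i k (transpose k b w) ≡ transpose i b (transpose i k w)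
  transpose-shift {i} {k} {b} b≢i b≢k w = begin
    transpose i k (transpose k b w)
      ≡⟨ transpose-natural (transpose-injective i k) k b w ⟩
    transpose (transpose i k k) (transpose i k b) (transpose i k w)
      ≡⟨ cong₂ (λ j l → transpose j l (transpose i k w)) (transpose-ʳ i k) (transpose-other b≢i b≢k) ⟩
    transpose i b (transpose i k w) ∎

-- Rational arithmetic and sums

·-as-* : ∀ k c → k · c ≡ (k · 1ℚ) * c
·-as-* k c = sym (trans (×-assoc-* k 1ℚ c) (cong (k ·_) (ℚ.*-identityˡ c)))

·1-nonNeg : ∀ k → ℚ.NonNegative (k · 1ℚ)
·1-nonNeg zero    = _
·1-nonNeg (suc k) = ℚ.nonNeg+nonNeg⇒nonNeg 1ℚ (k · 1ℚ) {{·1-nonNeg k}}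

suc·1-pos : ∀ k → ℚ.Positive (suc k · 1ℚ)
suc·1-pos k = ℚ.pos+nonNeg⇒pos 1ℚ (k · 1ℚ) {{·1-nonNeg k}}

1/suc : ℕ → ℚ
1/suc k = (1/ (suc k · 1ℚ)) {{ℚ.pos⇒nonZero (suc k · 1ℚ) {{suc·1-pos k}}}}

1/suc-inverse : ∀ k → 1/suc k * (suc k · 1ℚ) ≡ 1ℚ
1/suc-inverse k = ℚ.*-inverseˡ (suc k · 1ℚ) {{ℚ.pos⇒nonZero (suc k · 1ℚ) {{suc·1-pos k}}}}

1/suc-nonNeg : ∀ k → 0ℚ ℚ.≤ 1/suc k
1/suc-nonNeg k = ℚ.nonNegative⁻¹ (1/suc k)
  {{ℚ.pos⇒nonNeg (1/suc k) {{ℚ.1/pos⇒pos (suc k · 1ℚ) {{suc·1-pos k}}}}}}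

q+q≡1⇒q≡½ : ∀ {q} → q + q ≡ 1ℚ → q ≡ ½
q+q≡1⇒q≡½ {q} q+q≡1 = trans (solve 1 (λ q → q := con ½ :* (q :+ q)) refl q) (cong (½ *_) q+q≡1)

1/suc-cancelˡ : ∀ k q → 1/suc k * ((suc k · 1ℚ) * q) ≡ q
1/suc-cancelˡ k q = begin
  1/suc k * ((suc k · 1ℚ) * q)  ≡⟨ sym (ℚ.*-assoc (1/suc k) (suc k · 1ℚ) q) ⟩
  1/suc k * (suc k · 1ℚ) * q    ≡⟨ cong (_* q) (1/suc-inverse k) ⟩
  1ℚ * q                        ≡⟨ ℚ.*-identityˡ q ⟩
  q                             ∎

suc·1*q≡0⇒q≡0 : ∀ k {q} → (suc k · 1ℚ) * q ≡ 0ℚ → q ≡ 0ℚ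
suc·1*q≡0⇒q≡0 k {q} kq≡0 =
  trans (sym (1/suc-cancelˡ k q)) (trans (cong (1/suc k *_) kq≡0) (ℚ.*-zeroʳ (1/suc k)))

-- A row with off-diagonal entries q, r and k − 3 copies of c sums to k·c − 3c + q + r, and
-- balance says that twice a row sum is k − 1.
row-balance⇒½ : ∀ {k} c q r → 4 ≤ k → q + r ≡ 1ℚ →
               2 · (k · c + - c + (q - c) + (r - c)) ≡ (k ∸ 1) · 1ℚ → c ≡ ½
row-balance⇒½ c q r (ℕ.s≤s (ℕ.s≤s (ℕ.s≤s (ℕ.s≤s {n = m} ℕ.z≤n)))) q+r≡1 E = begin
  c                      ≡⟨ solve 1 (λ c → c := con ½ :* (c :+ c :- con 1ℚ) :+ con ½) refl c ⟩
  ½ * (c + c - 1ℚ) + ½   ≡⟨ cong (λ s → ½ * s + ½) (suc·1*q≡0⇒q≡0 m (trans expand collapse)) ⟩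
  ½ * 0ℚ + ½             ≡⟨ refl ⟩
  ½                      ∎
  where
  M = m · 1ℚ
  X = c + (c + (c + (c + M * c))) + - c + (q - c) + (r - c)
  E′ : X + (X + 0ℚ) ≡ 1ℚ + (1ℚ + (1ℚ + M))
  E′ = trans (cong (λ s → 2 · (c + (c + (c + (c + s))) + - c + (q - c) + (r - c))) (sym (·-as-* m c))) E
  expand : (1ℚ + M) * (c + c - 1ℚ) ≡ X + (X + 0ℚ) - (1ℚ + (1ℚ + (1ℚ + M))) - (q + r - 1ℚ) - (q + r - 1ℚ)
  expand = solve 4 (λ c q r M →
    let X = c :+ (c :+ (c :+ (c :+ M :* c))) :+ :- c :+ (q :- c) :+ (r :- c) in
    (con 1ℚ :+ M) :* (c :+ c :- con 1ℚ) :=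
    X :+ (X :+ con 0ℚ) :- (con 1ℚ :+ (con 1ℚ :+ (con 1ℚ :+ M))) :- (q :+ r :- con 1ℚ) :- (q :+ r :- con 1ℚ)) refl c q r M
  collapse : X + (X + 0ℚ) - (1ℚ + (1ℚ + (1ℚ + M))) - (q + r - 1ℚ) - (q + r - 1ℚ) ≡ 0ℚ
  collapse rewrite E′ | q+r≡1 =
    solve 1 (λ M → (con 1ℚ :+ (con 1ℚ :+ (con 1ℚ :+ M))) :- (con 1ℚ :+ (con 1ℚ :+ (con 1ℚ :+ M)))
                   :- (con 1ℚ :- con 1ℚ) :- (con 1ℚ :- con 1ℚ) := con 0ℚ) refl M

∑ : {A : Set} → List A → (A → ℚ) → ℚ
∑ xs f = sumℚ (map′ f xs)

private variable A B : Set

∑-cong : ∀ (xs : List A) {f g : A → ℚ} → (∀ {i} → i ∈ xs → f i ≡ g i) → ∑ xs f ≡ ∑ xs g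
∑-cong []       f≗g = refl
∑-cong (i ∷ xs) f≗g = cong₂ _+_ (f≗g (here refl)) (∑-cong xs (λ i∈xs → f≗g (there i∈xs)))

∑-congᴬ : ∀ {P : A → Set} {xs} {f g : A → ℚ} → AllL P xs → (∀ {i} → P i → f i ≡ g i) →
          ∑ xs f ≡ ∑ xs g
∑-congᴬ []         f≗g = refl
∑-congᴬ (pi ∷ pxs) f≗g = cong₂ _+_ (f≗g pi) (∑-congᴬ pxs f≗g)

∑-zero : ∀ (xs : List A) → ∑ xs (λ _ → 0ℚ) ≡ 0ℚ
∑-zero []       = refl
∑-zero (i ∷ xs) = trans (ℚ.+-identityˡ _) (∑-zero xs)

∑-const : ∀ (xs : List A) c → ∑ xs (λ _ → c) ≡ length xs · c
∑-const []       c = refl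
∑-const (i ∷ xs) c = cong (c +_) (∑-const xs c)

∑-+ : ∀ xs (f g : A → ℚ) → ∑ xs (λ i → f i + g i) ≡ ∑ xs f + ∑ xs g
∑-+ []       f g = refl
∑-+ (i ∷ xs) f g = trans (cong (f i + g i +_) (∑-+ xs f g))
  (solve 4 (λ a b c d → (a :+ b) :+ (c :+ d) := (a :+ c) :+ (b :+ d)) refl
         (f i) (g i) (∑ xs f) (∑ xs g))

∑-* : ∀ xs c (f : A → ℚ) → ∑ xs (λ i → c * f i) ≡ c * ∑ xs f
∑-* []       c f = sym (ℚ.*-zeroʳ c)
∑-* (i ∷ xs) c f = trans (cong (c * f i +_) (∑-* xs c f)) (sym (ℚ.*-distribˡ-+ c (f i) (∑ xs f)))

∑-++ : ∀ xs ys (f : A → ℚ) → ∑ (xs ++ ys) f ≡ ∑ xs f + ∑ ys f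
∑-++ []       ys f = sym (ℚ.+-identityˡ _)
∑-++ (i ∷ xs) ys f = trans (cong (f i +_) (∑-++ xs ys f)) (sym (ℚ.+-assoc (f i) _ _))

∑-map : ∀ (g : A → B) xs (f : B → ℚ) → ∑ (map′ g xs) f ≡ ∑ xs (λ i → f (g i))
∑-map g []       f = refl
∑-map g (i ∷ xs) f = cong (f (g i) +_) (∑-map g xs f)

∑-comm : ∀ (xs : List A) (ys : List B) (f : A → B → ℚ) →
         ∑ xs (λ i → ∑ ys (f i)) ≡ ∑ ys (λ j → ∑ xs (λ i → f i j))
∑-comm []       ys f = sym (∑-zero ys)
∑-comm (i ∷ xs) ys f = trans (cong (∑ ys (f i) +_) (∑-comm xs ys f))
  (sym (∑-+ ys (f i) (λ j → ∑ xs (λ i → f i j))))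

∑-· : ∀ k (xs : List A) f → k · ∑ xs f ≡ ∑ xs (λ i → k · f i)
∑-· k xs f = begin
  k · ∑ xs f               ≡⟨ ·-as-* k (∑ xs f) ⟩
  k · 1ℚ * ∑ xs f          ≡⟨ sym (∑-* xs (k · 1ℚ) f) ⟩
  ∑ xs (λ i → k · 1ℚ * f i) ≡⟨ ∑-cong xs (λ {i} _ → sym (·-as-* k (f i))) ⟩
  ∑ xs (λ i → k · f i)     ∎

mean : A → List A → (A → ℚ) → ℚ
mean x xs f = 1/suc (length xs) * ∑ (x ∷ xs) f

mean-const : ∀ (x : A) xs c → mean x xs (λ _ → c) ≡ c
mean-const x xs c = begin
  1/suc (length xs) * ∑ (x ∷ xs) (λ _ → c)       ≡⟨ cong (1/suc (length xs) *_) (∑-const (x ∷ xs) c) ⟩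
  1/suc (length xs) * (suc (length xs) · c)       ≡⟨ cong (1/suc (length xs) *_) (·-as-* (suc (length xs)) c) ⟩
  1/suc (length xs) * (suc (length xs) · 1ℚ * c)  ≡⟨ 1/suc-cancelˡ (length xs) c ⟩
  c                                               ∎

mean-cong : ∀ (x : A) xs {f g} → (∀ {i} → i ∈ x ∷ xs → f i ≡ g i) → mean x xs f ≡ mean x xs g
mean-cong x xs f≗g = cong (1/suc (length xs) *_) (∑-cong (x ∷ xs) f≗g)

module _ {n : ℕ} where

  δ : Fin n → Fin n → ℚ
  δ a i = if does (i ≟ a) then 1ℚ else 0ℚ

  δ-refl : ∀ a → δ a a ≡ 1ℚ
  δ-refl a rewrite dec-true (a ≟ a) refl = refl

  δ-other : ∀ {a i} → i ≢ a → δ a i ≡ 0ℚ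
  δ-other {a = a} {i} i≢a rewrite dec-false (i ≟ a) i≢a = refl

  ∑-δ-∉ : ∀ {a} xs → a ∉ xs → ∑ xs (δ a) ≡ 0ℚ
  ∑-δ-∉ []       a∉ = refl
  ∑-δ-∉ (i ∷ xs) a∉ = trans (cong₂ _+_ (δ-other (λ i≡a → a∉ (here (sym i≡a)))) (∑-δ-∉ xs (a∉ ∘ there)))
                            (ℚ.+-identityˡ 0ℚ)

  ∑-δ : ∀ {a xs} → Unique xs → a ∈ xs → ∑ xs (δ a) ≡ 1ℚ
  ∑-δ {xs = i ∷ xs} (i∉ ∷ _) (here refl) =
    trans (cong₂ _+_ (δ-refl i) (∑-δ-∉ xs (λ i∈ → All.lookup i∉ i∈ refl))) (ℚ.+-identityʳ 1ℚ)
  ∑-δ (i∉ ∷ uxs) (there a∈) =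
    trans (cong₂ _+_ (δ-other (All.lookup i∉ a∈)) (∑-δ uxs a∈)) (ℚ.+-identityˡ 1ℚ)

  ∑-+δ : ∀ {a xs} → Unique xs → a ∈ xs → ∀ f k → ∑ xs (λ i → f i + k * δ a i) ≡ ∑ xs f + k
  ∑-+δ {a} {xs} uxs a∈ f k = begin
    ∑ xs (λ i → f i + k * δ a i)     ≡⟨ ∑-+ xs f _ ⟩
    ∑ xs f + ∑ xs (λ i → k * δ a i)  ≡⟨ cong (∑ xs f +_) (∑-* xs k (δ a)) ⟩
    ∑ xs f + k * ∑ xs (δ a)          ≡⟨ cong (λ s → ∑ xs f + k * s) (∑-δ uxs a∈) ⟩
    ∑ xs f + k * 1ℚ                  ≡⟨ cong (∑ xs f +_) (ℚ.*-identityʳ k) ⟩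
    ∑ xs f + k                       ∎

  ∑-allFin-δ³ : ∀ c k₁ k₂ k₃ (a b e : Fin n) →
    ∑ (allFin n) (λ w → c + k₁ * δ a w + k₂ * δ b w + k₃ * δ e w) ≡ n · c + k₁ + k₂ + k₃
  ∑-allFin-δ³ c k₁ k₂ k₃ a b e = begin
    ∑ (allFin n) (λ w → c + k₁ * δ a w + k₂ * δ b w + k₃ * δ e w)
      ≡⟨ ∑-+δ uniq (∈-allFin e) _ k₃ ⟩
    ∑ (allFin n) (λ w → c + k₁ * δ a w + k₂ * δ b w) + k₃
      ≡⟨ cong (_+ k₃) (∑-+δ uniq (∈-allFin b) _ k₂) ⟩
    ∑ (allFin n) (λ w → c + k₁ * δ a w) + k₂ + k₃
      ≡⟨ cong (λ s → s + k₂ + k₃) (∑-+δ uniq (∈-allFin a) _ k₁) ⟩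
    ∑ (allFin n) (λ _ → c) + k₁ + k₂ + k₃
      ≡⟨ cong (λ s → s + k₁ + k₂ + k₃) (∑-const (allFin n) c) ⟩
    length (allFin n) · c + k₁ + k₂ + k₃
      ≡⟨ cong (λ l → l · c + k₁ + k₂ + k₃) (length-tabulate {n = n} id) ⟩
    n · c + k₁ + k₂ + k₃ ∎
    where uniq = allFin⁺ n

  transpose-via-δ : ∀ (f : Fin n → ℚ) a b i →
    f (transpose a b i) ≡ f i + (f b - f a) * δ a i + (f a - f b) * δ b i
  transpose-via-δ f a b i with a ≟ i | b ≟ i
  ... | yes refl | yes refl rewrite transpose-ˡ a a | δ-refl a =
    solve 1 (λ x → x := x :+ (x :- x) :* con 1ℚ :+ (x :- x) :* con 1ℚ) refl (f a)
  ... | yes refl | no b≢a rewrite transpose-ˡ a b | δ-refl a | δ-other (≢-sym b≢a) =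
    solve 2 (λ x y → y := x :+ (y :- x) :* con 1ℚ :+ (x :- y) :* con 0ℚ) refl (f a) (f b)
  ... | no a≢b | yes refl rewrite transpose-ʳ a b | δ-other (≢-sym a≢b) | δ-refl b =
    solve 2 (λ x y → x := y :+ (y :- x) :* con 0ℚ :+ (x :- y) :* con 1ℚ) refl (f a) (f b)
  ... | no a≢i | no b≢i
    rewrite transpose-other (≢-sym a≢i) (≢-sym b≢i) | δ-other (≢-sym a≢i) | δ-other (≢-sym b≢i) =
    solve 3 (λ x y z → z := z :+ (y :- x) :* con 0ℚ :+ (x :- y) :* con 0ℚ) refl (f a) (f b) (f i)

  ∑-transpose : ∀ {a b xs} → Unique xs → a ∈ xs → b ∈ xs → ∀ f →
                ∑ xs (λ i → f (transpose a b i)) ≡ ∑ xs f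
  ∑-transpose {a} {b} {xs} uxs a∈ b∈ f = begin
    ∑ xs (λ i → f (transpose a b i))
      ≡⟨ ∑-cong xs (λ {i} _ → transpose-via-δ f a b i) ⟩
    ∑ xs (λ i → f i + (f b - f a) * δ a i + (f a - f b) * δ b i)
      ≡⟨ ∑-+δ uxs b∈ _ (f a - f b) ⟩
    ∑ xs (λ i → f i + (f b - f a) * δ a i) + (f a - f b)
      ≡⟨ cong (_+ (f a - f b)) (∑-+δ uxs a∈ f (f b - f a)) ⟩
    ∑ xs f + (f b - f a) + (f a - f b)
      ≡⟨ solve 3 (λ s x y → s :+ (y :- x) :+ (x :- y) := s) refl (∑ xs f) (f a) (f b) ⟩
    ∑ xs f ∎

filter-absorb : ∀ {P Q : A → Set} (P? : ∀ x → Dec (P x)) (Q? : ∀ x → Dec (Q x)) →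
                (∀ {x} → P x → Q x) → ∀ xs → filter P? (filter Q? xs) ≡ filter P? xs
filter-absorb P? Q? P⇒Q []       = refl
filter-absorb P? Q? P⇒Q (x ∷ xs) with Q? x | P? x
... | yes _  | yes px rewrite dec-true (P? x) px = cong (x ∷_) (filter-absorb P? Q? P⇒Q xs)
... | yes _  | no ¬px rewrite dec-false (P? x) ¬px = filter-absorb P? Q? P⇒Q xs
... | no ¬qx | yes px = ⊥-elim (¬qx (P⇒Q px))
... | no _   | no _   = filter-absorb P? Q? P⇒Q xs

length-filter-< : ∀ {P Q : A → Set} (P? : ∀ x → Dec (P x)) (Q? : ∀ x → Dec (Q x)) →
                  (∀ {x} → P x → Q x) → ∀ {xs b} → b ∈ xs → Q b → ¬ P b →
                  length (filter P? xs) ℕ.< length (filter Q? xs)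
length-filter-< P? Q? P⇒Q {xs} b∈ qb ¬pb =
  subst (ℕ._< length (filter Q? xs)) (cong length (filter-absorb P? Q? P⇒Q xs))
    (filter-notAll P? (filter Q? xs) (Any.map (λ { refl → ¬pb }) (∈-filter⁺ Q? b∈ qb)))

four-distinct⇒4≤n : ∀ {n} {a b c d : Fin n} → a ≢ b → a ≢ c → a ≢ d → b ≢ c → b ≢ d → c ≢ d → 4 ≤ n
four-distinct⇒4≤n a≢b a≢c a≢d b≢c b≢d c≢d = injective⇒≤ (λ {i} {j} → lookup-injective distinct i j)
  where
  distinct = (a≢b ∷ a≢c ∷ a≢d ∷ []) ∷ (b≢c ∷ b≢d ∷ []) ∷ (c≢d ∷ []) ∷ [] ∷ []

-- The cone spanned by the vectors t[d]

Matrix : ℕ → Set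
Matrix n = Fin n → Fin n → ℚ

module _ {n : ℕ} where

  t-chosen : ∀ (d : ChoiceFn n) {u v} → ch d u v ≡ v → t d u v ≡ 1ℚ
  t-chosen d {u} {v} e with ch d u v ≟ v
  ... | yes _ = refl
  ... | no ¬e = ⊥-elim (¬e e)

  t-rejected : ∀ (d : ChoiceFn n) {u v} → ch d u v ≢ v → t d u v ≡ 0ℚ
  t-rejected d {u} {v} ¬e with ch d u v ≟ v
  ... | yes e = ⊥-elim (¬e e)
  ... | no _  = refl

  t-antisym : ∀ (d : ChoiceFn n) {u v} → u ≢ v → t d u v + t d v u ≡ 1ℚ
  t-antisym d {u} {v} u≢v with ch-in d u v
  ... | inj₁ e = trans (cong₂ _+_ (t-rejected d (λ e′ → u≢v (trans (sym e) e′)))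
                                  (t-chosen d (trans (ch-sym d v u) e)))
                       (ℚ.+-identityˡ 1ℚ)
  ... | inj₂ e = trans (cong₂ _+_ (t-chosen d e)
                                  (t-rejected d (λ e′ → u≢v (trans (sym e′) (trans (ch-sym d v u) e)))))
                       (ℚ.+-identityʳ 1ℚ)

  t-act : ∀ (π : Permutation′ n) d u v → t (act π d) u v ≡ t d (π ⟨$⟩ˡ u) (π ⟨$⟩ˡ v)
  t-act π d u v with ch d (π ⟨$⟩ˡ u) (π ⟨$⟩ˡ v) ≟ π ⟨$⟩ˡ v
  ... | yes e = t-chosen (act π d) (trans (cong (π ⟨$⟩ʳ_) e) (inverseʳ π))
  ... | no ¬e = t-rejected (act π d) (λ e → ¬e (trans (sym (inverseˡ π)) (cong (π ⟨$⟩ˡ_) e)))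

  Invariant : Fin n → Fin n → Matrix n → Set
  Invariant a b p = ∀ u v → p (transpose a b u) (transpose a b v) ≡ p u v

  -- InCone only constrains off-diagonal entries, so rows are summed through offDiag.
  offDiag : Matrix n → Matrix n
  offDiag p u v = if does (v ≟ u) then 0ℚ else p u v

  offDiag-diag : ∀ (p : Matrix n) u → offDiag p u u ≡ 0ℚ
  offDiag-diag p u rewrite dec-true (u ≟ u) refl = refl

  offDiag-off : ∀ (p : Matrix n) {u v} → v ≢ u → offDiag p u v ≡ p u v
  offDiag-off p {u} {v} v≢u rewrite dec-false (v ≟ u) v≢u = refl

  offDiag-row-decompose : ∀ (p : Matrix n) {a b e} → a ≢ b → a ≢ e → b ≢ e → ∀ {c} →
    (∀ {w} → w ≢ a → w ≢ b → w ≢ e → p a w ≡ c) →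
    ∀ w → offDiag p a w ≡ c + - c * δ a w + (p a b - c) * δ b w + (p a e - c) * δ e w
  offDiag-row-decompose p {a} {b} {e} a≢b a≢e b≢e {c} constant w with a ≟ w | b ≟ w | e ≟ w
  ... | yes refl | _ | _
    rewrite offDiag-diag p a | δ-refl a | δ-other {a = b} a≢b | δ-other {a = e} a≢e =
      solve 3 (λ c q r → con 0ℚ := c :+ :- c :* con 1ℚ :+ (q :- c) :* con 0ℚ :+ (r :- c) :* con 0ℚ)
        refl c (p a b) (p a e)
  ... | no _ | yes refl | _
    rewrite offDiag-off p (≢-sym a≢b) | δ-other {a = a} (≢-sym a≢b) | δ-refl b | δ-other {a = e} b≢e =
      solve 3 (λ c q r → q := c :+ :- c :* con 0ℚ :+ (q :- c) :* con 1ℚ :+ (r :- c) :* con 0ℚ)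
        refl c (p a b) (p a e)
  ... | no _ | no _ | yes refl
    rewrite offDiag-off p (≢-sym a≢e) | δ-other {a = a} (≢-sym a≢e) | δ-other {a = b} (≢-sym b≢e) | δ-refl e =
      solve 3 (λ c q r → r := c :+ :- c :* con 0ℚ :+ (q :- c) :* con 0ℚ :+ (r :- c) :* con 1ℚ)
        refl c (p a b) (p a e)
  ... | no a≢w | no b≢w | no e≢w
    rewrite offDiag-off p (≢-sym a≢w) | δ-other (≢-sym a≢w) | δ-other (≢-sym b≢w) | δ-other (≢-sym e≢w)
          | constant (≢-sym a≢w) (≢-sym b≢w) (≢-sym e≢w) =
      solve 3 (λ c q r → c := c :+ :- c :* con 0ℚ :+ (q :- c) :* con 0ℚ :+ (r :- c) :* con 0ℚ)
        refl c (p a b) (p a e)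

  ∑-offDiag-t : ∀ (d : ChoiceFn n) x xs →
    ∑ xs (offDiag (t d) x) ≡ length (filter (λ y → ¬? (y ≟ x) ×-dec (ch d x y ≟ y)) xs) · 1ℚ
  ∑-offDiag-t d x []       = refl
  ∑-offDiag-t d x (w ∷ xs) with w ≟ x | ch d x w ≟ w
  ... | yes _ | _     = trans (ℚ.+-identityˡ _) (∑-offDiag-t d x xs)
  ... | no _  | yes _ = cong (1ℚ +_) (∑-offDiag-t d x xs)
  ... | no _  | no _  = trans (ℚ.+-identityˡ _) (∑-offDiag-t d x xs)

AllL-++ : ∀ {P : A → Set} {xs ys} → AllL P xs → AllL P ys → AllL P (xs ++ ys)
AllL-++ []         pys = pys
AllL-++ (px ∷ pxs) pys = px ∷ AllL-++ pxs pys

AllL-map : ∀ {P : A → Set} {Q : B → Set} {f : A → B} → (∀ {x} → P x → Q (f x)) →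
           ∀ {xs} → AllL P xs → AllL Q (map′ f xs)
AllL-map P⇒Q []         = []
AllL-map P⇒Q (px ∷ pxs) = P⇒Q px ∷ AllL-map P⇒Q pxs

module _ {n : ℕ} (𝔇 : Family n) where

  -- InPrCl 𝔇 is, by definition, InCone 𝔇 1ℚ.
  InCone : ℚ → Matrix n → Set
  InCone a p = Σ (List (ℚ × ChoiceFn n)) λ ws →
      AllL (λ w → (0ℚ ℚ.≤ proj₁ w) × 𝔇 (proj₂ w)) ws
    × ∑ ws proj₁ ≡ a
    × (∀ u v → u ≢ v → ∑ ws (λ w → proj₁ w * t (proj₂ w) u v) ≡ p u v)

  inCone-t : ∀ {d} → 𝔇 d → InCone 1ℚ (t d)
  inCone-t {d} d∈𝔇 = (1ℚ , d) ∷ [] , (ℚ.nonNegative⁻¹ 1ℚ , d∈𝔇) ∷ [] , refl ,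
    λ u v _ → trans (ℚ.+-identityʳ _) (ℚ.*-identityˡ _)

  inCone-+ : ∀ {a b p q} → InCone a p → InCone b q → InCone (a + b) (λ u v → p u v + q u v)
  inCone-+ (ws , ok , Σw , Σt) (ws′ , ok′ , Σw′ , Σt′) =
    ws ++ ws′ , AllL-++ ok ok′ , trans (∑-++ ws ws′ proj₁) (cong₂ _+_ Σw Σw′) ,
    λ u v u≢v → trans (∑-++ ws ws′ _) (cong₂ _+_ (Σt u v u≢v) (Σt′ u v u≢v))

  inCone-scale : ∀ {a p} c → 0ℚ ℚ.≤ c → InCone a p → InCone (c * a) (λ u v → c * p u v)
  inCone-scale c 0≤c (ws , ok , Σw , Σt) =
    map′ scale ws , AllL-map scale-ok ok ,
    trans (∑-map scale ws proj₁) (trans (∑-* ws c proj₁) (cong (c *_) Σw)) ,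
    λ u v u≢v → begin
      ∑ (map′ scale ws) (λ w → proj₁ w * t (proj₂ w) u v)
        ≡⟨ ∑-map scale ws _ ⟩
      ∑ ws (λ w → c * proj₁ w * t (proj₂ w) u v)
        ≡⟨ ∑-cong ws (λ {w} _ → ℚ.*-assoc c (proj₁ w) _) ⟩
      ∑ ws (λ w → c * (proj₁ w * t (proj₂ w) u v))
        ≡⟨ ∑-* ws c _ ⟩
      c * ∑ ws (λ w → proj₁ w * t (proj₂ w) u v)
        ≡⟨ cong (c *_) (Σt u v u≢v) ⟩
      c * _ ∎
    where
    scale : ℚ × ChoiceFn n → ℚ × ChoiceFn n
    scale (r , d) = c * r , d
    scale-ok : ∀ {w} → (0ℚ ℚ.≤ proj₁ w) × 𝔇 (proj₂ w) →
               (0ℚ ℚ.≤ proj₁ (scale w)) × 𝔇 (proj₂ (scale w))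
    scale-ok {r , d} (0≤r , d∈𝔇) = ℚ.nonNegative⁻¹ (c * r)
      {{ℚ.nonNeg*nonNeg⇒nonNeg c {{ℚ.nonNegative 0≤c}} r {{ℚ.nonNegative 0≤r}}}} , d∈𝔇

  inCone-resp : ∀ {a p q} → (∀ u v → u ≢ v → p u v ≡ q u v) → InCone a p → InCone a q
  inCone-resp p≗q (ws , ok , Σw , Σt) = ws , ok , Σw , λ u v u≢v → trans (Σt u v u≢v) (p≗q u v u≢v)

  inCone-act : Symmetric 𝔇 → ∀ (π : Permutation′ n) {a p} →
               InCone a p → InCone a (λ u v → p (π ⟨$⟩ˡ u) (π ⟨$⟩ˡ v))
  inCone-act 𝔇-sym π (ws , ok , Σw , Σt) =
    map′ move ws , AllL-map (λ {w} (0≤r , d∈𝔇) → 0≤r , 𝔇-sym π (proj₂ w) d∈𝔇) ok ,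
    trans (∑-map move ws proj₁) Σw ,
    λ u v u≢v → begin
      ∑ (map′ move ws) (λ w → proj₁ w * t (proj₂ w) u v)
        ≡⟨ ∑-map move ws _ ⟩
      ∑ ws (λ w → proj₁ w * t (act π (proj₂ w)) u v)
        ≡⟨ ∑-cong ws (λ {w} _ → cong (proj₁ w *_) (t-act π (proj₂ w) u v)) ⟩
      ∑ ws (λ w → proj₁ w * t (proj₂ w) (π ⟨$⟩ˡ u) (π ⟨$⟩ˡ v))
        ≡⟨ Σt _ _ (λ e → u≢v (π⁻¹-injective e)) ⟩
      _ ∎
    where
    π⁻¹-injective : ∀ {u v} → π ⟨$⟩ˡ u ≡ π ⟨$⟩ˡ v → u ≡ v
    π⁻¹-injective e = trans (sym (inverseʳ π)) (trans (cong (π ⟨$⟩ʳ_) e) (inverseʳ π))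
    move : ℚ × ChoiceFn n → ℚ × ChoiceFn n
    move (r , d) = r , act π d

  inCone-∑ : ∀ (xs : List A) (P : A → Matrix n) → (∀ i → InCone 1ℚ (P i)) →
             InCone (length xs · 1ℚ) (λ u v → ∑ xs (λ i → P i u v))
  inCone-∑ []       P P∈ = [] , [] , refl , λ _ _ _ → refl
  inCone-∑ (i ∷ xs) P P∈ = inCone-+ (P∈ i) (inCone-∑ xs P P∈)

  inCone-mean : ∀ (x : A) xs (P : A → Matrix n) → (∀ i → InCone 1ℚ (P i)) →
                InCone 1ℚ (λ u v → mean x xs (λ i → P i u v))
  inCone-mean x xs P P∈ = subst (λ a → InCone a (λ u v → mean x xs (λ i → P i u v))) (1/suc-inverse (length xs))
    (inCone-scale (1/suc (length xs)) (1/suc-nonNeg (length xs)) (inCone-∑ (x ∷ xs) P P∈))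

  inCone-antisym : ∀ {a p} → InCone a p → ∀ {u v} → u ≢ v → p u v + p v u ≡ a
  inCone-antisym {a} {p} (ws , _ , Σw , Σt) {u} {v} u≢v = begin
    p u v + p v u
      ≡⟨ sym (cong₂ _+_ (Σt u v u≢v) (Σt v u (≢-sym u≢v))) ⟩
    ∑ ws (λ w → proj₁ w * t (proj₂ w) u v) + ∑ ws (λ w → proj₁ w * t (proj₂ w) v u)
      ≡⟨ sym (∑-+ ws _ _) ⟩
    ∑ ws (λ w → proj₁ w * t (proj₂ w) u v + proj₁ w * t (proj₂ w) v u)
      ≡⟨ ∑-cong ws (λ {w} _ → trans (sym (ℚ.*-distribˡ-+ (proj₁ w) _ _))
                                (trans (cong (proj₁ w *_) (t-antisym (proj₂ w) u≢v)) (ℚ.*-identityʳ _))) ⟩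
    ∑ ws proj₁
      ≡⟨ Σw ⟩
    a ∎

  inCone-rowSum : BalancedFamily 𝔇 → ∀ {a p} → InCone a p → ∀ x →
                  2 · ∑ (allFin n) (offDiag p x) ≡ (n ∸ 1) · a
  inCone-rowSum balanced {a} {p} (ws , ok , Σw , Σt) x = begin
    2 · ∑ (allFin n) (offDiag p x)
      ≡⟨ cong (2 ·_) (∑-cong (allFin n) (λ {w} _ → expand w)) ⟩
    2 · ∑ (allFin n) (λ w → ∑ ws (λ j → proj₁ j * offDiag (t (proj₂ j)) x w))
      ≡⟨ cong (2 ·_) (∑-comm (allFin n) ws _) ⟩
    2 · ∑ ws (λ j → ∑ (allFin n) (λ w → proj₁ j * offDiag (t (proj₂ j)) x w))
      ≡⟨ cong (2 ·_) (∑-cong ws (λ {j} _ → trans (∑-* (allFin n) (proj₁ j) _)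
                                              (cong (proj₁ j *_) (∑-offDiag-t (proj₂ j) x (allFin n))))) ⟩
    2 · ∑ ws (λ j → proj₁ j * (winCount (proj₂ j) x · 1ℚ))
      ≡⟨ ∑-· 2 ws _ ⟩
    ∑ ws (λ j → 2 · (proj₁ j * (winCount (proj₂ j) x · 1ℚ)))
      ≡⟨ ∑-congᴬ ok (λ {j} (_ , d∈𝔇) →
           double-count (proj₁ j) (winCount (proj₂ j) x) (balanced (proj₂ j) d∈𝔇 x)) ⟩
    ∑ ws (λ j → (n ∸ 1) · proj₁ j)
      ≡⟨ sym (∑-· (n ∸ 1) ws proj₁) ⟩
    (n ∸ 1) · ∑ ws proj₁
      ≡⟨ cong ((n ∸ 1) ·_) Σw ⟩
    (n ∸ 1) · a ∎
    where
    expand : ∀ w → offDiag p x w ≡ ∑ ws (λ j → proj₁ j * offDiag (t (proj₂ j)) x w)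
    expand w with w ≟ x
    ... | yes _   = sym (trans (∑-cong ws (λ {j} _ → ℚ.*-zeroʳ (proj₁ j))) (∑-zero ws))
    ... | no w≢x = sym (Σt x w (≢-sym w≢x))
    double-count : ∀ r k {m} → 2 ℕ.* k ≡ m → 2 · (r * (k · 1ℚ)) ≡ m · r
    double-count r k {m} 2k≡m = begin
      2 · (r * (k · 1ℚ))   ≡⟨ sym (×-comm-* 2 r (k · 1ℚ)) ⟩
      r * (2 · (k · 1ℚ))   ≡⟨ cong (r *_) (trans (×-assocˡ 1ℚ 2 k) (cong (_· 1ℚ) 2k≡m)) ⟩
      r * (m · 1ℚ)         ≡⟨ ×-comm-* m r 1ℚ ⟩
      m · (r * 1ℚ)         ≡⟨ cong (m ·_) (ℚ.*-identityʳ r) ⟩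
      m · r                ∎

module _ {n : ℕ} {𝔇 : Family n} where

  inCone-invariant-half : ∀ {p} → InCone 𝔇 1ℚ p → ∀ {a b} → Invariant a b p → a ≢ b → p a b ≡ ½
  inCone-invariant-half {p} p∈ {a} {b} inv a≢b =
    q+q≡1⇒q≡½ (trans (cong (p a b +_) (sym p-ba≡p-ab)) (inCone-antisym 𝔇 p∈ a≢b))
    where
    p-ba≡p-ab : p b a ≡ p a b
    p-ba≡p-ab = trans (sym (cong₂ p (transpose-ˡ a b) (transpose-ʳ a b))) (inv a b)

  inCone-row-half : BalancedFamily 𝔇 → ∀ {p} → InCone 𝔇 1ℚ p → ∀ {a b e w₀} →
    a ≢ b → a ≢ e → b ≢ e → w₀ ≢ a → w₀ ≢ b → w₀ ≢ e → p a b + p a e ≡ 1ℚ →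
    (∀ {w} → w ≢ a → w ≢ b → w ≢ e → p a w ≡ p a w₀) → p a w₀ ≡ ½
  inCone-row-half balanced {p} p∈ {a} {b} {e} {w₀} a≢b a≢e b≢e w₀≢a w₀≢b w₀≢e ab+ae≡1 constant =
    row-balance⇒½ c (p a b) (p a e)
      (four-distinct⇒4≤n a≢b a≢e (≢-sym w₀≢a) b≢e (≢-sym w₀≢b) (≢-sym w₀≢e)) ab+ae≡1
      (trans (cong (2 ·_) (sym row)) (inCone-rowSum 𝔇 balanced p∈ a))
    where
    c = p a w₀
    row : ∑ (allFin n) (offDiag p a) ≡ n · c + - c + (p a b - c) + (p a e - c)
    row = trans (∑-cong (allFin n) (λ {w} _ → offDiag-row-decompose p a≢b a≢e b≢e constant w))
                (∑-allFin-δ³ c (- c) (p a b - c) (p a e - c) a b e)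

-- Symmetrization

module _ {n : ℕ} where

  mean-transpose : ∀ {k : Fin n} {ks a b} → Unique (k ∷ ks) → a ∈ k ∷ ks → b ∈ k ∷ ks → ∀ f →
                   mean k ks (λ i → f (transpose a b i)) ≡ mean k ks f
  mean-transpose {k} {ks} u a∈ b∈ f = cong (1/suc (length ks) *_) (∑-transpose u a∈ b∈ f)

  -- The average of p over all permutations of ks: each of them is uniquely (i k) ∘ σ with
  -- i ∈ k ∷ ks and σ a permutation of ks.
  symmetrize : List (Fin n) → Matrix n → Matrix n
  symmetrize []       p u v = p u v
  symmetrize (k ∷ ks) p u v = mean k ks (λ i → symmetrize ks p (transpose i k u) (transpose i k v))

  symmetrize-inCone : ∀ {𝔇 : Family n} → Symmetric 𝔇 → ∀ ks {p} →
                      InCone 𝔇 1ℚ p → InCone 𝔇 1ℚ (symmetrize ks p)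
  symmetrize-inCone         𝔇-sym []       p∈ = p∈
  symmetrize-inCone {𝔇} 𝔇-sym (k ∷ ks) p∈ = inCone-mean 𝔇 k ks _
    (λ i → inCone-act 𝔇 𝔇-sym (Perm.transpose k i) (symmetrize-inCone 𝔇-sym ks p∈))

  symmetrize-fixes : ∀ ks p {u v} → u ∉ ks → v ∉ ks → symmetrize ks p u v ≡ p u v
  symmetrize-fixes []       p u∉ v∉ = refl
  symmetrize-fixes (k ∷ ks) p {u} {v} u∉ v∉ = begin
    mean k ks (λ i → symmetrize ks p (transpose i k u) (transpose i k v))
      ≡⟨ mean-cong k ks (λ i∈ → cong₂ (symmetrize ks p) (fixed u∉ i∈) (fixed v∉ i∈)) ⟩
    mean k ks (λ _ → symmetrize ks p u v)
      ≡⟨ mean-const k ks _ ⟩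
    symmetrize ks p u v
      ≡⟨ symmetrize-fixes ks p (λ u∈ → u∉ (there u∈)) (λ v∈ → v∉ (there v∈)) ⟩
    p u v ∎
    where
    fixed : ∀ {w i} → w ∉ k ∷ ks → i ∈ k ∷ ks → transpose i k w ≡ w
    fixed w∉ i∈ = transpose-other (λ { refl → w∉ i∈ }) (λ { refl → w∉ (here refl) })

  module _ {k : Fin n} {ks : List (Fin n)} {S : Matrix n} (k∉ks : k ∉ ks)
           (S-invariant : ∀ {a b} → a ∈ ks → b ∈ ks → Invariant a b S) (u v : Fin n) where

    private
      relabel : ∀ {σ σ′ : Fin n → Fin n} → (∀ w → σ w ≡ σ′ w) → S (σ u) (σ v) ≡ S (σ′ u) (σ′ v)
      relabel σ≗σ′ = cong₂ S (σ≗σ′ u) (σ≗σ′ v)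

      absorb : ∀ {c d} → c ∈ ks → d ∈ ks → ∀ {σ σ′ : Fin n → Fin n} →
               (∀ w → σ w ≡ transpose c d (σ′ w)) → S (σ u) (σ v) ≡ S (σ′ u) (σ′ v)
      absorb c∈ d∈ σ≗ = trans (relabel σ≗) (S-invariant c∈ d∈ _ _)

      index : ∀ {i j} → i ≡ j → S (transpose i k u) (transpose i k v) ≡ S (transpose j k u) (transpose j k v)
      index i≡j = cong (λ j → S (transpose j k u) (transpose j k v)) i≡j

      ≢k : ∀ {w} → w ∈ ks → w ≢ k
      ≢k w∈ refl = k∉ks w∈

      transpose-coset-k : ∀ {b i} → b ∈ ks → i ∈ k ∷ ks →
        S (transpose i k (transpose k b u)) (transpose i k (transpose k b v)) ≡
        S (transpose (transpose k b i) k u) (transpose (transpose k b i) k v)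
      transpose-coset-k {b} {i} b∈ i∈ with k ≟ i | b ≟ i
      ... | yes refl | _ =
        trans (relabel (λ w → trans (transpose-self i (transpose i b w)) (transpose-comm i b w)))
              (index (sym (transpose-ˡ i b)))
      ... | no _ | yes refl =
        trans (relabel (λ w → trans (cong (transpose i k) (transpose-comm k i w)) (transpose-involutive i k w)))
              (trans (relabel (λ w → sym (transpose-self k w))) (index (sym (transpose-ʳ k i))))
      ... | no k≢i | no b≢i with i∈
      ...   | here i≡k   = ⊥-elim (k≢i (sym i≡k))
      ...   | there i∈ks = trans (absorb i∈ks b∈ (transpose-shift b≢i (≢k b∈)))
                                 (index (sym (transpose-other (≢-sym k≢i) (≢-sym b≢i))))

    -- (i k) ∘ (a b) = ρ ∘ ((a b)(i) k), where ρ is the identity or a transposition of ks,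
    -- which S ignores.
    transpose-coset : ∀ {a b i} → a ∈ k ∷ ks → b ∈ k ∷ ks → i ∈ k ∷ ks →
      S (transpose i k (transpose a b u)) (transpose i k (transpose a b v)) ≡
      S (transpose (transpose a b i) k u) (transpose (transpose a b i) k v)
    transpose-coset {i = i} (here refl) (here refl) _ =
      trans (relabel (λ w → cong (transpose i k) (transpose-self k w))) (index (sym (transpose-self k i)))
    transpose-coset (here refl) (there b∈) i∈ = transpose-coset-k b∈ i∈
    transpose-coset {a} {i = i} (there a∈) (here refl) i∈ =
      trans (relabel (λ w → cong (transpose i k) (transpose-comm a k w)))
            (trans (transpose-coset-k a∈ i∈) (index (transpose-comm k a i)))
    transpose-coset {i = i} (there a∈) (there b∈) _ =
      absorb a∈ b∈ (transpose-conj (≢-sym (≢k a∈)) (≢-sym (≢k b∈)) i)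

  symmetrize-invariant : ∀ {ks} p → Unique ks → ∀ {a b} → a ∈ ks → b ∈ ks → Invariant a b (symmetrize ks p)
  symmetrize-invariant {k ∷ ks} p (k≢ks ∷ uks) {a} {b} a∈ b∈ u v = begin
    mean k ks (λ i → S (transpose i k (transpose a b u)) (transpose i k (transpose a b v)))
      ≡⟨ mean-cong k ks (transpose-coset k∉ks (symmetrize-invariant p uks) u v a∈ b∈) ⟩
    mean k ks (λ i → S (transpose (transpose a b i) k u) (transpose (transpose a b i) k v))
      ≡⟨ mean-transpose (k≢ks ∷ uks) a∈ b∈ (λ j → S (transpose j k u) (transpose j k v)) ⟩
    mean k ks (λ i → S (transpose i k u) (transpose i k v)) ∎
    where
    S = symmetrize ks p
    k∉ks : k ∉ ks
    k∉ks k∈ = All.lookup k≢ks k∈ refl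

-- Three-cycles in balanced tournaments

module _ {n : ℕ} where

  record Cycle (d : ChoiceFn n) (a b c : Fin n) : Set where
    field
      ab : ch d a b ≡ b
      bc : ch d b c ≡ c
      ca : ch d c a ≡ a

  cycle-act : ∀ (π : Permutation′ n) {d a b c} → Cycle d a b c →
              Cycle (act π d) (π ⟨$⟩ʳ a) (π ⟨$⟩ʳ b) (π ⟨$⟩ʳ c)
  cycle-act π {d} cyc = record
    { ab = trans (ch-act _ _) (cong (π ⟨$⟩ʳ_) (Cycle.ab cyc))
    ; bc = trans (ch-act _ _) (cong (π ⟨$⟩ʳ_) (Cycle.bc cyc))
    ; ca = trans (ch-act _ _) (cong (π ⟨$⟩ʳ_) (Cycle.ca cyc))
    }
    where
    ch-act : ∀ u v → ch (act π d) (π ⟨$⟩ʳ u) (π ⟨$⟩ʳ v) ≡ π ⟨$⟩ʳ ch d u v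
    ch-act u v = cong₂ (λ u′ v′ → π ⟨$⟩ʳ ch d u′ v′) (inverseˡ π) (inverseˡ π)

  cycle-distinct : ∀ {d a b c} → Cycle d a b c → a ≢ b → b ≢ c × a ≢ c
  cycle-distinct {d} cyc a≢b =
    (λ { refl → a≢b (trans (sym (Cycle.ca cyc)) (trans (ch-sym d _ _) (Cycle.ab cyc))) }) ,
    (λ { refl → a≢b (trans (sym (Cycle.bc cyc)) (trans (ch-sym d _ _) (Cycle.ab cyc))) })

  preferredTo : ChoiceFn n → Fin n → List (Fin n)
  preferredTo d a = filter (λ y → ¬? (y ≟ a) ×-dec (ch d a y ≟ y)) (allFin n)

  -- If no c closed the cycle a → b → c → a, everything preferred to b would be preferred to a,
  -- and so would b itself: b would lose strictly fewer comparisons than a.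
  balanced-cycle : 3 ≤ n → ∀ {d} → Balanced d → ∀ a → ∃₂ λ b c → a ≢ b × Cycle d a b c
  balanced-cycle 3≤n {d} balanced a = b , close (Any.any? (λ c → (ch d b c ≟ c) ×-dec (ch d c a ≟ a)) (allFin n))
    where
    positive : ∀ k → 2 ℕ.* k ≡ n ∸ 1 → 0 ℕ.< k
    positive zero    2k≡n-1 with subst (2 ℕ.≤_) (sym 2k≡n-1) (ℕ.∸-monoˡ-≤ 1 3≤n)
    ... | ()
    positive (suc k) _      = ℕ.z<s
    b : Fin n
    b = lookup (preferredTo d a) (fromℕ< (positive (winCount d a) (balanced a)))
    b-pref : b ≢ a × ch d a b ≡ b
    b-pref = proj₂ (∈-filter⁻ (λ y → ¬? (y ≟ a) ×-dec (ch d a y ≟ y)) {xs = allFin n} (∈-lookup _))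
    close : Dec (Any.Any (λ c → ch d b c ≡ c × ch d c a ≡ a) (allFin n)) → ∃ λ c → a ≢ b × Cycle d a b c
    close (yes found) with Any.satisfied found
    ... | c , bc , ca = c , ≢-sym (proj₁ b-pref) , record { ab = proj₂ b-pref ; bc = bc ; ca = ca }
    close (no none) = ⊥-elim (ℕ.<-irrefl equal-counts fewer)
      where
      b-pref⇒a-pref : ∀ {w} → w ≢ b × ch d b w ≡ w → w ≢ a × ch d a w ≡ w
      b-pref⇒a-pref {w} (w≢b , bw) = w≢a , a-to-w (ch-in d w a)
        where
        w≢a : w ≢ a
        w≢a refl = proj₁ b-pref (sym (trans (sym bw) (trans (ch-sym d b w) (proj₂ b-pref))))
        a-to-w : ch d w a ≡ w ⊎ ch d w a ≡ a → ch d a w ≡ w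
        a-to-w (inj₁ wa≡w) = trans (ch-sym d a w) wa≡w
        a-to-w (inj₂ wa≡a) = ⊥-elim (none (Any.map (λ { refl → bw , wa≡a }) (∈-allFin w)))
      fewer : winCount d b ℕ.< winCount d a
      fewer = length-filter-< _ _ b-pref⇒a-pref (∈-allFin b) b-pref (λ (b≢b , _) → b≢b refl)
      equal-counts : winCount d b ≡ winCount d a
      equal-counts = ℕ.*-cancelˡ-≡ (winCount d b) (winCount d a) 2 (trans (balanced b) (sym (balanced a)))

  cycle-cong : ∀ {d a b c a′ b′ c′} → a ≡ a′ → b ≡ b′ → c ≡ c′ → Cycle d a b c → Cycle d a′ b′ c′
  cycle-cong refl refl refl cyc = cyc

  cycle-relabel : ∀ {𝔇 : Family n} → Symmetric 𝔇 → ∀ {d x b c y z} → 𝔇 d → Cycle d x b c →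
                  x ≢ b → x ≢ y → y ≢ z → x ≢ z → ∃ λ d′ → 𝔇 d′ × Cycle d′ x y z
  cycle-relabel 𝔇-sym {d} {x} {b} {c} {y} {z} d∈𝔇 cyc x≢b x≢y y≢z x≢z =
    act τ₂ (act τ₁ d) , 𝔇-sym τ₂ _ (𝔇-sym τ₁ d d∈𝔇) ,
    cycle-cong (transpose-other (≢-sym c₁≢x) x≢z) (transpose-other (≢-sym c₁≢y) y≢z) (transpose-ˡ c₁ z)
      (cycle-act τ₂ cyc₁)
    where
    τ₁ = Perm.transpose b y
    c₁ = transpose b y c
    τ₂ = Perm.transpose c₁ z
    b≢c = proj₁ (cycle-distinct cyc x≢b)
    x≢c = proj₂ (cycle-distinct cyc x≢b)
    cyc₁ : Cycle (act τ₁ d) x y c₁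
    cyc₁ = cycle-cong (transpose-other x≢b x≢y) (transpose-ˡ b y) refl (cycle-act τ₁ cyc)
    c₁≢x : c₁ ≢ x
    c₁≢x c₁≡x = x≢c (sym (transpose-injective b y (trans c₁≡x (sym (transpose-other x≢b x≢y)))))
    c₁≢y : c₁ ≢ y
    c₁≢y c₁≡y = b≢c (sym (transpose-injective b y (trans c₁≡y (sym (transpose-ˡ b y)))))

-- Identifying t^⟨x,y,z⟩

module _ {n : ℕ} (x y z : Fin n) where

  others : List (Fin n)
  others = filter (λ w → ¬? (w ≟ x) ×-dec ¬? (w ≟ y) ×-dec ¬? (w ≟ z)) (allFin n)

  others-unique : Unique others
  others-unique = filter⁺ _ (allFin⁺ n)

  ∈-others⁺ : ∀ {w} → w ≢ x → w ≢ y → w ≢ z → w ∈ others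
  ∈-others⁺ {w} w≢x w≢y w≢z = ∈-filter⁺ _ (∈-allFin w) (w≢x , w≢y , w≢z)

  ∈-others⁻ : ∀ {w} → w ∈ others → w ≢ x × w ≢ y × w ≢ z
  ∈-others⁻ w∈ = proj₂ (∈-filter⁻ _ {xs = allFin n} w∈)

  x∉others : x ∉ others
  x∉others x∈ = proj₁ (∈-others⁻ x∈) refl

  y∉others : y ∉ others
  y∉others y∈ = proj₁ (proj₂ (∈-others⁻ y∈)) refl

  z∉others : z ∉ others
  z∉others z∈ = proj₂ (proj₂ (∈-others⁻ z∈)) refl

  data Position : Fin n → Set where
    is-x    : Position x
    is-y    : Position y
    is-z    : Position z
    outside : ∀ {w} → w ∈ others → Position w

  position : ∀ w → Position w
  position w with w ≟ x | w ≟ y | w ≟ z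
  ... | yes refl | _        | _        = is-x
  ... | no _     | yes refl | _        = is-y
  ... | no _     | no _     | yes refl = is-z
  ... | no w≢x   | no w≢y   | no w≢z   = outside (∈-others⁺ w≢x w≢y w≢z)

module _ {n : ℕ} {x y z : Fin n} (x≢y : x ≢ y) (y≢z : y ≢ z) (x≢z : x ≢ z) where

  private
    same : ∀ (a : Fin n) → (a ≟ a) ≡ yes refl
    same a = ≡-≟-identity _≟_ refl
    diff : ∀ {a b : Fin n} (a≢b : a ≢ b) → (a ≟ b) ≡ no a≢b
    diff = ≢-≟-identity _≟_
    y≢x = ≢-sym x≢y
    z≢y = ≢-sym y≢z
    z≢x = ≢-sym x≢z

  -- t³ inspects its arguments in two successive `with` blocks, hence some rewrites occur twice.
  t³-xy : t³ x y z x y ≡ 1ℚ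
  t³-xy rewrite same x | same y = refl
  t³-yz : t³ x y z y z ≡ 1ℚ
  t³-yz rewrite diff y≢x | diff z≢y | same y | same z = refl
  t³-zx : t³ x y z z x ≡ 1ℚ
  t³-zx rewrite diff z≢x | diff x≢y | diff z≢y | diff x≢z | same z | same x = refl
  t³-yx : t³ x y z y x ≡ 0ℚ
  t³-yx rewrite diff y≢x | diff x≢y | same y | diff x≢z | diff y≢z | same x | same y = refl
  t³-zy : t³ x y z z y ≡ 0ℚ
  t³-zy rewrite diff z≢x | same y | diff z≢y | diff y≢z | same z | diff y≢x | diff z≢y | same z | same y = refl
  t³-xz : t³ x y z x z ≡ 0ℚ
  t³-xz rewrite same x | diff z≢y | diff x≢y | same z | diff x≢z | diff z≢x
              | diff x≢y | diff x≢z | same x | same z = refl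
  t³-u-outside : ∀ {u} v → u ≢ x → u ≢ y → u ≢ z → t³ x y z u v ≡ ½
  t³-u-outside v u≢x u≢y u≢z rewrite diff u≢x | diff u≢y | diff u≢z | diff u≢x | diff u≢y | diff u≢z = refl
  t³-x-outside : ∀ {v} → v ≢ x → v ≢ y → v ≢ z → t³ x y z x v ≡ ½
  t³-x-outside v≢x v≢y v≢z
    rewrite same x | diff v≢x | diff v≢y | diff v≢z | diff x≢y | diff x≢z
          | same x | diff v≢x | diff v≢y | diff v≢z | diff x≢y | diff x≢z = refl
  t³-y-outside : ∀ {v} → v ≢ x → v ≢ y → v ≢ z → t³ x y z y v ≡ ½
  t³-y-outside v≢x v≢y v≢z
    rewrite same y | diff v≢x | diff v≢y | diff v≢z | diff y≢x | diff y≢z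
          | same y | diff v≢x | diff v≢y | diff v≢z | diff y≢x | diff y≢z = refl
  t³-z-outside : ∀ {v} → v ≢ x → v ≢ y → v ≢ z → t³ x y z z v ≡ ½
  t³-z-outside v≢x v≢y v≢z
    rewrite same z | diff v≢x | diff v≢y | diff v≢z | diff z≢x | diff z≢y
          | same z | diff v≢x | diff v≢y | diff v≢z | diff z≢x | diff z≢y = refl

  t³-outsideˡ : ∀ {u} v → u ∈ others x y z → t³ x y z u v ≡ ½
  t³-outsideˡ v u∈ with ∈-others⁻ x y z u∈
  ... | u≢x , u≢y , u≢z = t³-u-outside v u≢x u≢y u≢z

  t³-outsideʳ : ∀ u {v} → v ∈ others x y z → t³ x y z u v ≡ ½
  t³-outsideʳ u v∈ with position x y z u | ∈-others⁻ x y z v∈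
  ... | is-x       | v≢x , v≢y , v≢z = t³-x-outside v≢x v≢y v≢z
  ... | is-y       | v≢x , v≢y , v≢z = t³-y-outside v≢x v≢y v≢z
  ... | is-z       | v≢x , v≢y , v≢z = t³-z-outside v≢x v≢y v≢z
  ... | outside u∈ | _ = t³-outsideˡ _ u∈

module _ {n : ℕ} {𝔇 : Family n} (balanced : BalancedFamily 𝔇) {x y z : Fin n}
         (x≢y : x ≢ y) (y≢z : y ≢ z) (x≢z : x ≢ z)
         {p : Matrix n} (p∈ : InCone 𝔇 1ℚ p) (p-xy : p x y ≡ 1ℚ) (p-yz : p y z ≡ 1ℚ) (p-zx : p z x ≡ 1ℚ)
         (invariant : ∀ {a b} → a ∈ others x y z → b ∈ others x y z → Invariant a b p) where

  private
    R = others x y z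
    z≢x = ≢-sym x≢z
    z≢y = ≢-sym y≢z
    y≢x = ≢-sym x≢y

  p-reverse : ∀ {u v q} → u ≢ v → p u v ≡ q → p v u ≡ 1ℚ - q
  p-reverse {u} {v} {q} u≢v p-uv≡q = begin
    p v u                        ≡⟨ solve 2 (λ a b → b := (a :+ b) :- a) refl (p u v) (p v u) ⟩
    (p u v + p v u) - p u v      ≡⟨ cong₂ _-_ (inCone-antisym 𝔇 p∈ u≢v) p-uv≡q ⟩
    1ℚ - q                       ∎

  constant-on-R : ∀ {a w w′} → a ∉ R → w ∈ R → w′ ∈ R → p a w′ ≡ p a w
  constant-on-R {a} {w} {w′} a∉ w∈ w′∈ =
    trans (sym (cong₂ p (transpose-other (λ { refl → a∉ w∈ }) (λ { refl → a∉ w′∈ })) (transpose-ˡ w w′)))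
          (invariant w∈ w′∈ a w)

  row-half : ∀ {w} → w ∈ R → p x w ≡ ½ × p y w ≡ ½ × p z w ≡ ½
  row-half {w} w∈ with ∈-others⁻ x y z w∈
  ... | w≢x , w≢y , w≢z =
    inCone-row-half balanced p∈ x≢y x≢z y≢z w≢x w≢y w≢z (cong₂ _+_ p-xy (p-reverse z≢x p-zx))
      (λ w′≢x w′≢y w′≢z → constant-on-R (x∉others x y z) w∈ (∈-others⁺ x y z w′≢x w′≢y w′≢z)) ,
    inCone-row-half balanced p∈ y≢z y≢x z≢x w≢y w≢z w≢x (cong₂ _+_ p-yz (p-reverse x≢y p-xy))
      (λ w′≢y w′≢z w′≢x → constant-on-R (y∉others x y z) w∈ (∈-others⁺ x y z w′≢x w′≢y w′≢z)) ,
    inCone-row-half balanced p∈ z≢x z≢y x≢y w≢z w≢x w≢y (cong₂ _+_ p-zx (p-reverse y≢z p-yz))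
      (λ w′≢z w′≢x w′≢y → constant-on-R (z∉others x y z) w∈ (∈-others⁺ x y z w′≢x w′≢y w′≢z))

  p-outsideʳ : ∀ u {v} → u ≢ v → v ∈ R → p u v ≡ ½
  p-outsideʳ u u≢v v∈ with position x y z u
  ... | is-x       = proj₁ (row-half v∈)
  ... | is-y       = proj₁ (proj₂ (row-half v∈))
  ... | is-z       = proj₂ (proj₂ (row-half v∈))
  ... | outside u∈ = inCone-invariant-half p∈ (invariant u∈ v∈) u≢v

  p-outsideˡ : ∀ {u} v → u ≢ v → u ∈ R → p u v ≡ ½
  p-outsideˡ v u≢v u∈ = p-reverse (≢-sym u≢v) (p-outsideʳ v (≢-sym u≢v) u∈)

  symmetric-cyclic⇒t³ : ∀ u v → u ≢ v → p u v ≡ t³ x y z u v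
  symmetric-cyclic⇒t³ u v u≢v with position x y z u | position x y z v
  ... | _          | outside v∈ = trans (p-outsideʳ u u≢v v∈) (sym (t³-outsideʳ x≢y y≢z x≢z u v∈))
  ... | outside u∈ | _          = trans (p-outsideˡ v u≢v u∈) (sym (t³-outsideˡ x≢y y≢z x≢z v u∈))
  ... | is-x | is-x = ⊥-elim (u≢v refl)
  ... | is-x | is-y = trans p-xy (sym (t³-xy x≢y y≢z x≢z))
  ... | is-x | is-z = trans (p-reverse z≢x p-zx) (sym (t³-xz x≢y y≢z x≢z))
  ... | is-y | is-x = trans (p-reverse x≢y p-xy) (sym (t³-yx x≢y y≢z x≢z))
  ... | is-y | is-y = ⊥-elim (u≢v refl)
  ... | is-y | is-z = trans p-yz (sym (t³-yz x≢y y≢z x≢z))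
  ... | is-z | is-x = trans p-zx (sym (t³-zx x≢y y≢z x≢z))
  ... | is-z | is-y = trans (p-reverse y≢z p-yz) (sym (t³-zy x≢y y≢z x≢z))
  ... | is-z | is-z = ⊥-elim (u≢v refl)

claim3p5 : (n : ℕ) → 3 ≤ n → (𝔇 : Family n) →
    NonEmpty 𝔇 → Symmetric 𝔇 → BalancedFamily 𝔇 →
    (x y z : Fin n) → x ≢ y → y ≢ z → x ≢ z →
    InPrCl 𝔇 (t³ x y z)
claim3p5 n 3≤n 𝔇 (d , d∈𝔇) 𝔇-sym balanced x y z x≢y y≢z x≢z
  with balanced-cycle 3≤n (balanced d d∈𝔇) x
... | b , c , x≢b , cyc with cycle-relabel 𝔇-sym d∈𝔇 cyc x≢b x≢y y≢z x≢z
... | d′ , d′∈𝔇 , cyc′ = inCone-resp 𝔇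
  (symmetric-cyclic⇒t³ balanced x≢y y≢z x≢z P∈
    (P-chosen (x∉others x y z) (y∉others x y z) (Cycle.ab cyc′))
    (P-chosen (y∉others x y z) (z∉others x y z) (Cycle.bc cyc′))
    (P-chosen (z∉others x y z) (x∉others x y z) (Cycle.ca cyc′))
    (symmetrize-invariant (t d′) (others-unique x y z)))
  P∈
  where
  R = others x y z
  P∈ : InCone 𝔇 1ℚ (symmetrize R (t d′))
  P∈ = symmetrize-inCone 𝔇-sym R (inCone-t 𝔇 d′∈𝔇)
  P-chosen : ∀ {u v} → u ∉ R → v ∉ R → ch d′ u v ≡ v → symmetrize R (t d′) u v ≡ 1ℚ
  P-chosen u∉ v∉ uv≡v = trans (symmetrize-fixes R (t d′) u∉ v∉) (t-chosen d′ uv≡v)
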